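{- (1) If two sharp proper interval representations $\alpha,\alpha'$ of a graph $G$ determine the same geometric order, then $\alpha=\alpha'$. (2) Suppose $G$ has at most one universal vertex. If two sharp proper arc representations $\alpha,\alpha'$ of $G$ determine the same geometric order, then they are equal up to rotation, i.e., $\alpha'=\sigma\circ\alpha$ for some rotation $\sigma$ of the circle.
   Context: A proper arc representation of a graph $G$ is a bijection $\alpha$ from $V(G)$ to a family of arcs $[a,b]$ (points met going forward from $a$ to $b$; $a$ is the left and $b$ the right endpoint) of the circle $\mathbb{C}_m=\{1,\dots,m\}$ with circular order $1,\dots,m,1$, such that $u,v$ adjacent iff their arcs intersect, and no vertex's arc contains another vertex's arc. A proper interval representation is the same with intervals $[a,b]$ of the linearly ordered set $\{1,\dots,m\}$. A representation is sharp if no two of its arcs/intervals share an endpoint and every point of $\{1,\dots,m\}$ is an endpoint of some arc/interval (so $m=2|V(G)|$). The geometric order $\prec_\alpha$ is the linear (for intervals) or circular (for arcs) order on $V(G)$ according to the order of the left endpoints of the $\alpha(v)$. Rotations of $\mathbb{C}_m$ are the maps $x\mapsto (x+s)\bmod m+1$. A vertex is universal if adjacent to all other vertices. -}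

module Defs where

open import Level using (0ℓ)
open import Data.Nat using (ℕ; zero; suc; _+_; _≤_; _<_; _*_)
open import Data.Nat.DivMod using (_%_; m%n<n)
open import Data.Fin using (Fin; toℕ; fromℕ<)
open import Data.Product using (Σ; ∃; _×_; _,_; proj₁; proj₂)
open import Data.Sum using (_⊎_)
open import Relation.Nullary using (¬_)
open import Relation.Binary.PropositionalEquality using (_≡_; _≢_)
open import Function.Bundles using (_⇔_)

record Graph (n : ℕ) : Set₁ where
  field
    Adj    : Fin n → Fin n → Set
    sym    : ∀ {u v} → Adj u v → Adj v u
    irrefl : ∀ {u} → ¬ Adj u u
open Graph public

Universal : ∀ {n} → Graph n → Fin n → Set
Universal G u = ∀ v → v ≢ u → Adj G u v

AtMostOneUniversal : ∀ {n} → Graph n → Set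
AtMostOneUniversal G = ∀ u v → Universal G u → Universal G v → u ≡ v

-- Points 1..m are represented by Fin m (point i+1 ↔ i).
-- A segment (interval or arc) [a,b] is the pair (a , b): left endpoint a, right endpoint b.
Seg : ℕ → Set
Seg m = Fin m × Fin m

left right : ∀ {m} → Seg m → Fin m
left  = proj₁
right = proj₂

InInterval : ∀ {m} → Seg m → Fin m → Set
InInterval (a , b) x = toℕ a ≤ toℕ x × toℕ x ≤ toℕ b

-- x ∈ [a,b] for an arc of the circle: the points met going forward from a to b
InArc : ∀ {m} → Seg m → Fin m → Set
InArc (a , b) x =
  (toℕ a ≤ toℕ b × toℕ a ≤ toℕ x × toℕ x ≤ toℕ b)
  ⊎ (toℕ b < toℕ a × (toℕ a ≤ toℕ x ⊎ toℕ x ≤ toℕ b))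

record IsProperRep {n m : ℕ} (Mem : Seg m → Fin m → Set) (G : Graph n)
                   (α : Fin n → Seg m) : Set where
  field
    injective : ∀ u v → α u ≡ α v → u ≡ v
    adjacency : ∀ u v → u ≢ v → (Adj G u v ⇔ (∃ λ x → Mem (α u) x × Mem (α v) x))
    proper    : ∀ u v → u ≢ v → ¬ (∀ x → Mem (α u) x → Mem (α v) x)

record IsProperIntervalRep {n m : ℕ} (G : Graph n) (α : Fin n → Seg m) : Set where
  field
    rep        : IsProperRep InInterval G α
    wellformed : ∀ v → toℕ (left (α v)) ≤ toℕ (right (α v))

IsProperArcRep : ∀ {n m} → Graph n → (Fin n → Seg m) → Set
IsProperArcRep G α = IsProperRep InArc G α

record IsSharp {n m : ℕ} (α : Fin n → Seg m) : Set where
  field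
    size      : m ≡ 2 * n
    distinct  : ∀ u v → u ≢ v →
                  left (α u) ≢ left (α v) × left (α u) ≢ right (α v)
                  × right (α u) ≢ left (α v) × right (α u) ≢ right (α v)
    covering  : ∀ x → ∃ λ v → x ≡ left (α v) ⊎ x ≡ right (α v)

-- Linear geometric order: u ≺ v iff left endpoint of u is before that of v.
SameLinearOrder : ∀ {n m} → (α α' : Fin n → Seg m) → Set
SameLinearOrder α α' = ∀ u v →
  (toℕ (left (α u)) < toℕ (left (α v))) ⇔ (toℕ (left (α' u)) < toℕ (left (α' v)))

Cyclic : ℕ → ℕ → ℕ → Set
Cyclic a b c = (a < b × b < c) ⊎ (b < c × c < a) ⊎ (c < a × a < b)

SameCircularOrder : ∀ {n m} → (α α' : Fin n → Seg m) → Set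
SameCircularOrder α α' = ∀ u v w →
  Cyclic (toℕ (left (α u))) (toℕ (left (α v))) (toℕ (left (α w)))
  ⇔ Cyclic (toℕ (left (α' u))) (toℕ (left (α' v))) (toℕ (left (α' w)))

-- Rotation x ↦ (x + s) mod m + 1 of {1..m}; in 0-based form x ↦ (x + 1 + s) mod m.
-- (s ranges over all of ℕ, so this is exactly the set of all cyclic shifts.)
rotate : ∀ {m} → ℕ → Fin m → Fin m
rotate {zero}  s ()
rotate {suc k} s x = fromℕ< (m%n<n (suc (toℕ x) + s) (suc k))

rotateSeg : ∀ {m} → ℕ → Seg m → Seg m
rotateSeg s (a , b) = rotate s a , rotate s b

-- The endpoints of a sharp representation occupy the m = 2n points
-- bijectively (a Layout), and a layout is determined by the outcomes of all
-- comparisons between its endpoints (layout-unique, resting on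
-- enumerations-coincide).  It therefore suffices to express each comparison
-- (left/left, left/right, right/right) through data both representations share.
-- (1) For intervals, left/right comparisons are described by adjacency and the
--     linear order, and right/right ones agree with left/left by properness.
-- (2) For arcs, coordinates are shifted so that the left end of a fixed vertex
--     sits at 0 (Shift, Comparisons), and comparisons are described by the
--     circular order and the relation "w starts inside u".  This relation is
--     determined by G and the circular order (startsIn-preserved), because a
--     pair for which it flips consists of two universal vertices.  Equal
--     shifted layouts differ by the rotation taking one base point to the
--     other (shift-equal⇒rotate).
module Submission where

open import Defs
open import Data.Nat using (ℕ)
open import Data.Fin using (Fin)
open import Data.Product using (_×_; ∃)
open import Relation.Binary.PropositionalEquality using (_≡_)

open import Data.Nat using (zero; suc; _+_; _*_; _∸_; _≤_; _<_; z≤n; NonZero)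
open import Data.Nat.Properties
open import Data.Nat.Induction using (<-rec)
open import Data.Nat.DivMod using (_%_; %-distribˡ-+; m%n%n≡m%n; [m+n]%n≡m%n; m<n⇒m%n≡m)
open import Data.Nat.Tactic.RingSolver using (solve-∀)
open import Data.Fin using (toℕ; fromℕ<; combine; punchOut) renaming (zero to fzero; suc to fsuc)
open import Data.Fin.Properties using (toℕ-injective; toℕ<n; toℕ-fromℕ<; combine-injective; punchOut-injective; injective⇒≤) renaming (_≟_ to _≟ᶠ_)
open import Data.Product using (_,_; proj₁; proj₂; swap) renaming (map to ×-map)
open import Data.Product.Properties using (×-≡,≡→≡)
open import Data.Sum using (_⊎_; inj₁; inj₂)
open import Function using (_∘_)
open import Function.Bundles using (_⇔_; Equivalence; mk⇔)
open import Function.Construct.Composition using (_⇔-∘_)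
open import Function.Construct.Symmetry using (⇔-sym)
open import Relation.Nullary using (¬_; Dec; yes; no; contradiction)
open import Relation.Nullary.Decidable using (_×-dec_; _⊎-dec_)
open import Relation.Binary using (tri<; tri≈; tri>)
open import Relation.Binary.PropositionalEquality
  using (_≢_; refl; trans; cong; subst; subst₂; module ≡-Reasoning) renaming (sym to ≡-sym)

AgreeAt : ∀ {E : Set} → (E → ℕ) → (E → ℕ) → ℕ → Set
AgreeAt p q k = (∀ e → p e ≡ k → q e ≡ k) × (∀ e → q e ≡ k → p e ≡ k)

agree-step : ∀ {E : Set} {m} (p q : E → ℕ) → (∀ e → p e < m) →
             (∀ k → k < m → ∃ λ e → q e ≡ k) →
             (∀ e e' → q e < q e' → p e < p e') →
             ∀ k → (∀ j → j < k → AgreeAt p q j) → ∀ e → p e ≡ k → q e ≡ k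
agree-step p q p<m q-onto q⇒p k below e refl with <-cmp (q e) (p e)
... | tri< qe<pe _ _ = contradiction (proj₂ (below (q e) qe<pe) e refl) (>⇒≢ qe<pe)
... | tri≈ _ qe≡pe _ = qe≡pe
... | tri> _ _ pe<qe with q-onto (p e) (p<m e)
...   | e' , qe'≡pe = contradiction (trans (≡-sym qe'≡pe) (proj₁ (below (p e') pe'<pe) e' refl)) (>⇒≢ pe'<pe)
  where
  pe'<pe : p e' < p e
  pe'<pe = q⇒p e' e (subst (_< q e) (≡-sym qe'≡pe) pe<qe)

enumerations-coincide :
  ∀ {E : Set} {m} (p q : E → ℕ) → (∀ e → p e < m) → (∀ e → q e < m) →
  (∀ k → k < m → ∃ λ e → p e ≡ k) → (∀ k → k < m → ∃ λ e → q e ≡ k) →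
  (∀ e e' → p e < p e' ⇔ q e < q e') → ∀ e → p e ≡ q e
enumerations-coincide p q p<m q<m p-onto q-onto same e =
  ≡-sym (proj₁ (agree (p e)) e refl)
  where
  agree : ∀ k → AgreeAt p q k
  agree = <-rec _ λ k below →
      agree-step p q p<m q-onto (λ e e' → Equivalence.from (same e e')) k (λ j j<k → below j<k)
    , agree-step q p q<m p-onto (λ e e' → Equivalence.to (same e e')) k (λ j j<k → swap (below j<k))

data Endpoint (n : ℕ) : Set where
  lend rend : Fin n → Endpoint n

-- This is a
-- sharp representation with its endpoints read as numbers.
record Layout (n m : ℕ) : Set where
  field
    L R         : Fin n → ℕ
    L<m         : ∀ v → L v < m
    R<m         : ∀ v → R v < m
    L-injective : ∀ {u w} → L u ≡ L w → u ≡ w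
    R-injective : ∀ {u w} → R u ≡ R w → u ≡ w
    L≢R         : ∀ u w → L u ≢ R w
    occupied    : ∀ k → k < m → ∃ λ v → L v ≡ k ⊎ R v ≡ k

  pos : Endpoint n → ℕ
  pos (lend v) = L v
  pos (rend v) = R v

  pos<m : ∀ e → pos e < m
  pos<m (lend v) = L<m v
  pos<m (rend v) = R<m v

  pos-onto : ∀ k → k < m → ∃ λ e → pos e ≡ k
  pos-onto k k<m with occupied k k<m
  ... | v , inj₁ Lv≡k = lend v , Lv≡k
  ... | v , inj₂ Rv≡k = rend v , Rv≡k

  L≮R⇒R<L : ∀ u w → ¬ (L w < R u) → R u < L w
  L≮R⇒R<L u w L≮R = ≤∧≢⇒< (≮⇒≥ L≮R) (λ Ru≡Lw → L≢R w u (≡-sym Ru≡Lw))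

open Layout public

record SameEndpointOrder {n m} (A B : Layout n m) : Set where
  field
    left-left   : ∀ u w → L A u < L A w ⇔ L B u < L B w
    left-right  : ∀ u w → L A w < R A u ⇔ L B w < R B u
    right-right : ∀ u w → R A u < R A w ⇔ R B u < R B w

layout-unique : ∀ {n m} (A B : Layout n m) → SameEndpointOrder A B →
                ∀ v → L A v ≡ L B v × R A v ≡ R B v
layout-unique A B same v = coincide (lend v) , coincide (rend v)
  where
  open SameEndpointOrder same
  right-left : ∀ u w → R A u < L A w → R B u < L B w
  right-left u w Ru<Lw =
    L≮R⇒R<L B u w (λ Lw<Ru → <-asym Ru<Lw (Equivalence.from (left-right u w) Lw<Ru))
  right-left′ : ∀ u w → R B u < L B w → R A u < L A w
  right-left′ u w Ru<Lw =
    L≮R⇒R<L A u w (λ Lw<Ru → <-asym Ru<Lw (Equivalence.to (left-right u w) Lw<Ru))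
  same-order : ∀ e e' → pos A e < pos A e' ⇔ pos B e < pos B e'
  same-order (lend u) (lend w) = left-left u w
  same-order (lend w) (rend u) = left-right u w
  same-order (rend u) (lend w) = mk⇔ (right-left u w) (right-left′ u w)
  same-order (rend u) (rend w) = right-right u w
  coincide : ∀ e → pos A e ≡ pos B e
  coincide = enumerations-coincide (pos A) (pos B) (pos<m A) (pos<m B)
                                   (pos-onto A) (pos-onto B) same-order

-- If left (α v₀) ≡
-- right (α v₀), then the endpoint sitting at each point x (taking the left end
-- of v₀ at the shared point) defines an injection from the m = 2n points into
-- the 2n endpoints which misses the right end of v₀; so m ≤ 2n - 1.
sharp⇒left≢right : ∀ {n m} (α : Fin n → Seg m) → IsSharp α →
                   ∀ v → left (α v) ≢ right (α v)
sharp⇒left≢right {suc n'} {m} α sharp v₀ degenerate =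
  <⇒≱ 2n-1<m (injective⇒≤ index-injective)
  where
  open IsSharp sharp
  Ends : Set
  Ends = Fin (suc n') × Fin 2

  place : Ends → Fin m
  place (v , fzero)  = left (α v)
  place (v , fsuc _) = right (α v)

  endpointAt : Fin m → Ends
  endpointAt x with covering x
  ... | v , inj₁ _ = v , fzero
  ... | v , inj₂ _ with v ≟ᶠ v₀
  ...   | yes _ = v , fzero
  ...   | no _  = v , fsuc fzero

  place-endpointAt : ∀ x → place (endpointAt x) ≡ x
  place-endpointAt x with covering x
  ... | v , inj₁ x≡l = ≡-sym x≡l
  ... | v , inj₂ x≡r with v ≟ᶠ v₀
  ...   | yes refl = trans degenerate (≡-sym x≡r)
  ...   | no _     = ≡-sym x≡r

  endpointAt-avoids : ∀ x → endpointAt x ≢ (v₀ , fsuc fzero)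
  endpointAt-avoids x with covering x
  ... | v , inj₁ _ = λ ()
  ... | v , inj₂ _ with v ≟ᶠ v₀
  ...   | yes _  = λ ()
  ...   | no v≢v₀ = v≢v₀ ∘ cong proj₁

  code : Ends → Fin (suc n' * 2)
  code (v , i) = combine v i

  code-injective : ∀ e e' → code e ≡ code e' → e ≡ e'
  code-injective (v , i) (v' , i') eq with combine-injective v i v' i' eq
  ... | refl , refl = refl

  code-avoids : ∀ x → code (v₀ , fsuc fzero) ≢ code (endpointAt x)
  code-avoids x = endpointAt-avoids x ∘ code-injective _ _ ∘ ≡-sym

  index : Fin m → Fin (suc (n' * 2))
  index x = punchOut (code-avoids x)

  index-injective : ∀ {x y} → index x ≡ index y → x ≡ y
  index-injective {x} {y} eq = begin
    x                      ≡⟨ ≡-sym (place-endpointAt x) ⟩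
    place (endpointAt x)   ≡⟨ cong place (code-injective (endpointAt x) (endpointAt y)
                                (punchOut-injective (code-avoids x) (code-avoids y) eq)) ⟩
    place (endpointAt y)   ≡⟨ place-endpointAt y ⟩
    y                      ∎
    where open ≡-Reasoning

  2n-1<m : suc (n' * 2) < m
  2n-1<m = subst (suc (n' * 2) <_) (≡-sym (trans size (*-comm 2 (suc n')))) (n<1+n _)

sharpLayout : ∀ {n m} (α : Fin n → Seg m) → IsSharp α → Layout n m
sharpLayout {n} {m} α sharp = record
  { L           = λ v → toℕ (left (α v))
  ; R           = λ v → toℕ (right (α v))
  ; L<m         = λ v → toℕ<n (left (α v))
  ; R<m         = λ v → toℕ<n (right (α v))
  ; L-injective = injective-by (proj₁ ∘ distinct _ _)
  ; R-injective = injective-by (proj₂ ∘ proj₂ ∘ proj₂ ∘ distinct _ _)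
  ; L≢R         = L≢R′
  ; occupied    = occupied′
  }
  where
  open IsSharp sharp
  injective-by : {f : Fin n → Fin m} → (∀ {u w} → u ≢ w → f u ≢ f w) →
                 ∀ {u w} → toℕ (f u) ≡ toℕ (f w) → u ≡ w
  injective-by separated {u} {w} eq with u ≟ᶠ w
  ... | yes u≡w = u≡w
  ... | no u≢w  = contradiction (toℕ-injective eq) (separated u≢w)

  L≢R′ : ∀ u w → toℕ (left (α u)) ≢ toℕ (right (α w))
  L≢R′ u w eq with u ≟ᶠ w
  ... | yes refl = sharp⇒left≢right α sharp u (toℕ-injective eq)
  ... | no u≢w   = proj₁ (proj₂ (distinct u w u≢w)) (toℕ-injective eq)

  occupied′ : ∀ k → k < m → ∃ λ v → toℕ (left (α v)) ≡ k ⊎ toℕ (right (α v)) ≡ k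
  occupied′ k k<m with covering (fromℕ< k<m)
  ... | v , inj₁ k≡l = v , inj₁ (trans (cong toℕ (≡-sym k≡l)) (toℕ-fromℕ< k<m))
  ... | v , inj₂ k≡r = v , inj₂ (trans (cong toℕ (≡-sym k≡r)) (toℕ-fromℕ< k<m))

layout-determines : ∀ {n m} (α α' : Fin n → Seg m) (sharp : IsSharp α) (sharp' : IsSharp α') →
                    ∀ v → L (sharpLayout α sharp) v ≡ L (sharpLayout α' sharp') v
                        × R (sharpLayout α sharp) v ≡ R (sharpLayout α' sharp') v →
                    α v ≡ α' v
layout-determines α α' sharp sharp' v = ×-≡,≡→≡ ∘ ×-map toℕ-injective toℕ-injective

-- Comparisons of endpoints in a sharp proper interval representation,
-- expressed through the graph and the left/left comparisons.
module IntervalRep {n m} (G : Graph n) (α : Fin n → Seg m)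
                   (interval : IsProperIntervalRep G α) (sharp : IsSharp α) where
  open IsProperIntervalRep interval
  open IsProperRep rep

  A : Layout n m
  A = sharpLayout α sharp

  L<R : ∀ v → L A v < R A v
  L<R v = ≤∧≢⇒< (wellformed v) (L≢R A v v)

  L<L⇒≢ : ∀ {u w} → L A u < L A w → u ≢ w
  L<L⇒≢ Lu<Lw refl = <-irrefl refl Lu<Lw

  -- Properness: an interval starting later also ends later.
  L<L⇒R<R : ∀ {u w} → L A u < L A w → R A u < R A w
  L<L⇒R<R {u} {w} Lu<Lw with <-cmp (R A u) (R A w)
  ... | tri< Ru<Rw _ _ = Ru<Rw
  ... | tri≈ _ Ru≡Rw _ = contradiction (R-injective A Ru≡Rw) (L<L⇒≢ Lu<Lw)
  ... | tri> _ _ Rw<Ru = contradiction w⊆u (proper w u (L<L⇒≢ Lu<Lw ∘ ≡-sym))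
    where
    w⊆u : ∀ x → InInterval (α w) x → InInterval (α u) x
    w⊆u x (Lw≤x , x≤Rw) = ≤-trans (<⇒≤ Lu<Lw) Lw≤x , ≤-trans x≤Rw (<⇒≤ Rw<Ru)

  R<R⇔L<L : ∀ u w → R A u < R A w ⇔ L A u < L A w
  R<R⇔L<L u w = mk⇔ R<R⇒L<L L<L⇒R<R
    where
    R<R⇒L<L : R A u < R A w → L A u < L A w
    R<R⇒L<L Ru<Rw with <-cmp (L A u) (L A w)
    ... | tri< Lu<Lw _ _ = Lu<Lw
    ... | tri≈ _ Lu≡Lw _ = contradiction (cong (R A) (L-injective A Lu≡Lw)) (<⇒≢ Ru<Rw)
    ... | tri> _ _ Lw<Lu = contradiction (L<L⇒R<R Lw<Lu) (<-asym Ru<Rw)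

  -- The combinatorial content of "w starts before u ends": w is u, w starts
  -- before u, or w starts after u and meets it.
  BeforeEndOf : Fin n → Fin n → Set
  BeforeEndOf u w = w ≡ u ⊎ L A w < L A u ⊎ (L A u < L A w × Adj G u w)

  L<R⇔BeforeEndOf : ∀ u w → L A w < R A u ⇔ BeforeEndOf u w
  L<R⇔BeforeEndOf u w = mk⇔ to from
    where
    to : L A w < R A u → BeforeEndOf u w
    to Lw<Ru with <-cmp (L A w) (L A u)
    ... | tri< Lw<Lu _ _ = inj₂ (inj₁ Lw<Lu)
    ... | tri≈ _ Lw≡Lu _ = inj₁ (L-injective A Lw≡Lu)
    ... | tri> _ _ Lu<Lw = inj₂ (inj₂ (Lu<Lw , Equivalence.from (adjacency u w (L<L⇒≢ Lu<Lw))
                             (left (α w) , (<⇒≤ Lu<Lw , <⇒≤ Lw<Ru) , (≤-refl , wellformed w))))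
    from : BeforeEndOf u w → L A w < R A u
    from (inj₁ refl)           = L<R u
    from (inj₂ (inj₁ Lw<Lu))   = <-trans Lw<Lu (L<R u)
    from (inj₂ (inj₂ (Lu<Lw , adj)))
      with Equivalence.to (adjacency u w (L<L⇒≢ Lu<Lw)) adj
    ... | x , (_ , x≤Ru) , (Lw≤x , _) = ≤∧≢⇒< (≤-trans Lw≤x x≤Ru) (L≢R A w u)

interval-rep-unique :
  ∀ {n m} (G : Graph n) (α α' : Fin n → Seg m) →
  IsProperIntervalRep G α → IsSharp α → IsProperIntervalRep G α' → IsSharp α' →
  SameLinearOrder α α' → ∀ v → α v ≡ α' v
interval-rep-unique G α α' interval sharp interval' sharp' same v =
  layout-determines α α' sharp sharp' v (layout-unique I.A I'.A endpoint-order v)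
  where
  module I  = IntervalRep G α interval sharp
  module I' = IntervalRep G α' interval' sharp'
  before-end : ∀ u w → I.BeforeEndOf u w ⇔ I'.BeforeEndOf u w
  before-end u w = mk⇔ to from
    where
    to : I.BeforeEndOf u w → I'.BeforeEndOf u w
    to (inj₁ w≡u)                = inj₁ w≡u
    to (inj₂ (inj₁ Lw<Lu))       = inj₂ (inj₁ (Equivalence.to (same w u) Lw<Lu))
    to (inj₂ (inj₂ (Lu<Lw , a))) = inj₂ (inj₂ (Equivalence.to (same u w) Lu<Lw , a))
    from : I'.BeforeEndOf u w → I.BeforeEndOf u w
    from (inj₁ w≡u)                = inj₁ w≡u
    from (inj₂ (inj₁ Lw<Lu))       = inj₂ (inj₁ (Equivalence.from (same w u) Lw<Lu))
    from (inj₂ (inj₂ (Lu<Lw , a))) = inj₂ (inj₂ (Equivalence.from (same u w) Lu<Lw , a))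
  endpoint-order : SameEndpointOrder I.A I'.A
  endpoint-order = record
    { left-left   = same
    ; left-right  = λ u w → ⇔-sym (I'.L<R⇔BeforeEndOf u w) ⇔-∘ (before-end u w ⇔-∘ I.L<R⇔BeforeEndOf u w)
    ; right-right = λ u w → ⇔-sym (I'.R<R⇔L<L u w) ⇔-∘ (same u w ⇔-∘ I.R<R⇔L<L u w)
    }

cyclic-rotate : ∀ {a b c} → Cyclic a b c → Cyclic b c a
cyclic-rotate (inj₁ a<b<c)        = inj₂ (inj₂ a<b<c)
cyclic-rotate (inj₂ (inj₁ b<c<a)) = inj₁ b<c<a
cyclic-rotate (inj₂ (inj₂ c<a<b)) = inj₂ (inj₁ c<a<b)

cyclic⇒≢ : ∀ {a b c} → Cyclic a b c → a ≢ b
cyclic⇒≢ (inj₁ (a<b , _))          a≡b  = <⇒≢ a<b a≡b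
cyclic⇒≢ (inj₂ (inj₁ (b<c , c<a))) refl = <-asym b<c c<a
cyclic⇒≢ (inj₂ (inj₂ (_ , a<b)))   a≡b  = <⇒≢ a<b a≡b

cyclic-asym : ∀ {a b c} → Cyclic a b c → ¬ Cyclic a c b
cyclic-asym (inj₁ (p , q))        (inj₁ (r , s))        = <-asym q s
cyclic-asym (inj₁ (p , q))        (inj₂ (inj₁ (r , s))) = <-asym p s
cyclic-asym (inj₁ (p , q))        (inj₂ (inj₂ (r , s))) = <-asym p r
cyclic-asym (inj₂ (inj₁ (p , q))) (inj₁ (r , s))        = <-asym p s
cyclic-asym (inj₂ (inj₁ (p , q))) (inj₂ (inj₁ (r , s))) = <-asym p r
cyclic-asym (inj₂ (inj₁ (p , q))) (inj₂ (inj₂ (r , s))) = <-asym q s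
cyclic-asym (inj₂ (inj₂ (p , q))) (inj₁ (r , s))        = <-asym p r
cyclic-asym (inj₂ (inj₂ (p , q))) (inj₂ (inj₁ (r , s))) = <-asym q s
cyclic-asym (inj₂ (inj₂ (p , q))) (inj₂ (inj₂ (r , s))) = <-asym p s

cyclic? : ∀ a b c → Dec (Cyclic a b c)
cyclic? a b c = ((a <? b) ×-dec (b <? c))
          ⊎-dec (((b <? c) ×-dec (c <? a)) ⊎-dec ((c <? a) ×-dec (a <? b)))

cyclic-total : ∀ {a b c} → a ≢ b → b ≢ c → a ≢ c → Cyclic a b c ⊎ Cyclic a c b
cyclic-total {a} {b} {c} a≢b b≢c a≢c with <-cmp a b | <-cmp b c | <-cmp a c
... | tri≈ _ e _ | _          | _          = contradiction e a≢b
... | _          | tri≈ _ e _ | _          = contradiction e b≢c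
... | _          | _          | tri≈ _ e _ = contradiction e a≢c
... | tri< p _ _ | tri< q _ _ | _          = inj₁ (inj₁ (p , q))
... | tri< p _ _ | tri> _ _ q | tri< r _ _ = inj₂ (inj₁ (r , q))
... | tri< p _ _ | tri> _ _ q | tri> _ _ r = inj₁ (inj₂ (inj₂ (r , p)))
... | tri> _ _ p | tri< q _ _ | tri< r _ _ = inj₂ (inj₂ (inj₂ (p , r)))
... | tri> _ _ p | tri< q _ _ | tri> _ _ r = inj₁ (inj₂ (inj₁ (q , r)))
... | tri> _ _ p | tri> _ _ q | _          = inj₂ (inj₂ (inj₁ (q , p)))

cyclic-from-0 : ∀ {x y} → Cyclic 0 x y → 0 < x × x < y
cyclic-from-0 (inj₁ 0<x<y)        = 0<x<y
cyclic-from-0 (inj₂ (inj₁ (_ , ())))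
cyclic-from-0 (inj₂ (inj₂ (() , _)))

-- Membership in the arc [a, b] of the circle 0..m-1, on plain numbers
-- (InArc (a , b) x unfolds to OnArc (toℕ a) (toℕ b) (toℕ x)).
OnArc : ℕ → ℕ → ℕ → Set
OnArc a b x = (a ≤ b × a ≤ x × x ≤ b) ⊎ (b < a × (a ≤ x ⊎ x ≤ b))

AtOrBetween : ℕ → ℕ → ℕ → Set
AtOrBetween a b x = x ≡ a ⊎ x ≡ b ⊎ Cyclic a x b

-- A point lies on an arc iff it is at or between its endpoints; so arcs only
-- depend on the cyclic order.
OnArc⇔ : ∀ a b x → OnArc a b x ⇔ AtOrBetween a b x
OnArc⇔ a b x = mk⇔ to from
  where
  to : OnArc a b x → AtOrBetween a b x
  to (inj₁ (_ , a≤x , x≤b)) with m≤n⇒m<n∨m≡n a≤x | m≤n⇒m<n∨m≡n x≤b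
  ... | inj₂ a≡x | _        = inj₁ (≡-sym a≡x)
  ... | inj₁ _   | inj₂ x≡b = inj₂ (inj₁ x≡b)
  ... | inj₁ a<x | inj₁ x<b = inj₂ (inj₂ (inj₁ (a<x , x<b)))
  to (inj₂ (b<a , inj₁ a≤x)) with m≤n⇒m<n∨m≡n a≤x
  ... | inj₂ a≡x = inj₁ (≡-sym a≡x)
  ... | inj₁ a<x = inj₂ (inj₂ (inj₂ (inj₂ (b<a , a<x))))
  to (inj₂ (b<a , inj₂ x≤b)) with m≤n⇒m<n∨m≡n x≤b
  ... | inj₂ x≡b = inj₂ (inj₁ x≡b)
  ... | inj₁ x<b = inj₂ (inj₂ (inj₂ (inj₁ (x<b , b<a))))
  from : AtOrBetween a b x → OnArc a b x
  from (inj₁ refl) with a ≤? b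
  ... | yes a≤b = inj₁ (a≤b , ≤-refl , a≤b)
  ... | no a≰b  = inj₂ (≰⇒> a≰b , inj₁ ≤-refl)
  from (inj₂ (inj₁ refl)) with a ≤? b
  ... | yes a≤b = inj₁ (a≤b , a≤b , ≤-refl)
  ... | no a≰b  = inj₂ (≰⇒> a≰b , inj₂ ≤-refl)
  from (inj₂ (inj₂ (inj₁ (a<x , x<b))))        = inj₁ (<⇒≤ (<-trans a<x x<b) , <⇒≤ a<x , <⇒≤ x<b)
  from (inj₂ (inj₂ (inj₂ (inj₁ (x<b , b<a))))) = inj₂ (b<a , inj₂ (<⇒≤ x<b))
  from (inj₂ (inj₂ (inj₂ (inj₂ (b<a , a<x))))) = inj₂ (b<a , inj₁ (<⇒≤ a<x))

-- Shifting the circle 0..m-1 so that the point c becomes 0: shift x is the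
-- distance from c to x going forward.
module Shift (m c : ℕ) (c<m : c < m) where
  shift : ℕ → ℕ
  shift x with c ≤? x
  ... | yes _ = x ∸ c
  ... | no _  = x + (m ∸ c)

  shift-≥ : ∀ {x} → c ≤ x → shift x ≡ x ∸ c
  shift-≥ {x} c≤x with c ≤? x
  ... | yes _  = refl
  ... | no c≰x = contradiction c≤x c≰x

  shift-< : ∀ {x} → x < c → shift x ≡ x + (m ∸ c)
  shift-< {x} x<c with c ≤? x
  ... | yes c≤x = contradiction c≤x (<⇒≱ x<c)
  ... | no _    = refl

  [m∸c]+c≡m : (m ∸ c) + c ≡ m
  [m∸c]+c≡m = m∸n+n≡m (<⇒≤ c<m)

  shift<m : ∀ {x} → x < m → shift x < m
  shift<m {x} x<m with c ≤? x
  ... | yes _  = ≤-<-trans (m∸n≤m x c) x<m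
  ... | no c≰x = subst (x + (m ∸ c) <_) (trans (+-comm c (m ∸ c)) [m∸c]+c≡m)
                       (+-monoˡ-< (m ∸ c) (≰⇒> c≰x))

  shift-c : shift c ≡ 0
  shift-c = trans (shift-≥ ≤-refl) (n∸n≡0 c)

  shift-mono-≥ : ∀ {x y} → c ≤ x → x < y → shift x < shift y
  shift-mono-≥ c≤x x<y =
    subst₂ _<_ (≡-sym (shift-≥ c≤x)) (≡-sym (shift-≥ (≤-trans c≤x (<⇒≤ x<y)))) (∸-monoˡ-< x<y c≤x)

  shift-mono-< : ∀ {x y} → x < y → y < c → shift x < shift y
  shift-mono-< x<y y<c =
    subst₂ _<_ (≡-sym (shift-< (<-trans x<y y<c))) (≡-sym (shift-< y<c)) (+-monoˡ-< _ x<y)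

  shift-wrap : ∀ {x y} → c ≤ x → x < m → y < c → shift x < shift y
  shift-wrap {x} {y} c≤x x<m y<c = subst₂ _<_ (≡-sym (shift-≥ c≤x)) (≡-sym (shift-< y<c))
    (<-≤-trans (∸-monoˡ-< x<m c≤x) (m≤n+m (m ∸ c) y))

  shift-≢ : ∀ {x y} → x < y → y < m → shift x ≢ shift y
  shift-≢ {x} {y} x<y y<m = by-cases (c ≤? x) (c ≤? y)
    where
    by-cases : Dec (c ≤ x) → Dec (c ≤ y) → shift x ≢ shift y
    by-cases (yes c≤x) _         = <⇒≢ (shift-mono-≥ c≤x x<y)
    by-cases (no c≰x)  (yes c≤y) = >⇒≢ (shift-wrap c≤y y<m (≰⇒> c≰x))
    by-cases (no _)    (no c≰y)  = <⇒≢ (shift-mono-< x<y (≰⇒> c≰y))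

  shift-injective : ∀ {x y} → x < m → y < m → shift x ≡ shift y → x ≡ y
  shift-injective {x} {y} x<m y<m eq with <-cmp x y
  ... | tri< x<y _ _ = contradiction eq (shift-≢ x<y y<m)
  ... | tri≈ _ x≡y _ = x≡y
  ... | tri> _ _ y<x = contradiction (≡-sym eq) (shift-≢ y<x x<m)

  shift-onto : ∀ {k} → k < m → ∃ λ x → x < m × shift x ≡ k
  shift-onto {k} k<m with k <? (m ∸ c)
  ... | yes k<m∸c = k + c
                  , subst (k + c <_) [m∸c]+c≡m (+-monoˡ-< c k<m∸c)
                  , trans (shift-≥ (m≤n+m c k)) (m+n∸n≡m k c)
  ... | no k≮m∸c  = k ∸ (m ∸ c) , <-trans x<c c<m , trans (shift-< x<c) (m∸n+n≡m (≮⇒≥ k≮m∸c))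
    where
    x<c : k ∸ (m ∸ c) < c
    x<c = +-cancelʳ-< (m ∸ c) _ _
            (subst₂ _<_ (≡-sym (m∸n+n≡m (≮⇒≥ k≮m∸c)))
                        (≡-sym (trans (+-comm c (m ∸ c)) [m∸c]+c≡m)) k<m)

  shift-pos : ∀ {y} → y < m → y ≢ c → 0 < shift y
  shift-pos {y} y<m y≢c =
    n≢0⇒n>0 (λ shift-y≡0 → y≢c (shift-injective y<m c<m (trans shift-y≡0 (≡-sym shift-c))))

  shift-increasing-cyclic : ∀ {a b e} → a < b → b < e → e < m → Cyclic (shift a) (shift b) (shift e)
  shift-increasing-cyclic {a} {b} {e} a<b b<e e<m = by-cases (c ≤? a) (c ≤? b) (c ≤? e)
    where
    by-cases : Dec (c ≤ a) → Dec (c ≤ b) → Dec (c ≤ e) → Cyclic (shift a) (shift b) (shift e)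
    by-cases (yes c≤a) _         _         =
      inj₁ (shift-mono-≥ c≤a a<b , shift-mono-≥ (≤-trans c≤a (<⇒≤ a<b)) b<e)
    by-cases (no c≰a)  (yes c≤b) _         =
      inj₂ (inj₁ (shift-mono-≥ c≤b b<e , shift-wrap (≤-trans c≤b (<⇒≤ b<e)) e<m (≰⇒> c≰a)))
    by-cases (no c≰a)  (no c≰b)  (yes c≤e) =
      inj₂ (inj₂ (shift-wrap c≤e e<m (≰⇒> c≰a) , shift-mono-< a<b (≰⇒> c≰b)))
    by-cases (no _)    (no c≰b)  (no c≰e)  =
      inj₁ (shift-mono-< a<b (≰⇒> c≰b) , shift-mono-< b<e (≰⇒> c≰e))

  shift-cyclic : ∀ {a b e} → a < m → b < m → e < m → Cyclic a b e → Cyclic (shift a) (shift b) (shift e)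
  shift-cyclic a<m b<m e<m (inj₁ (a<b , b<e))        = shift-increasing-cyclic a<b b<e e<m
  shift-cyclic a<m b<m e<m (inj₂ (inj₁ (b<e , e<a))) = cyclic-rotate (cyclic-rotate (shift-increasing-cyclic b<e e<a a<m))
  shift-cyclic a<m b<m e<m (inj₂ (inj₂ (e<a , a<b))) = cyclic-rotate (shift-increasing-cyclic e<a a<b b<m)

  -- The converse follows from totality of the cyclic order.
  shift-cyclic⁻¹ : ∀ {a b e} → a < m → b < m → e < m → Cyclic (shift a) (shift b) (shift e) → Cyclic a b e
  shift-cyclic⁻¹ {a} {b} {e} a<m b<m e<m cyc with cyclic-total a≢b b≢e a≢e
    where
    a≢b : a ≢ b
    a≢b refl = cyclic⇒≢ cyc refl
    b≢e : b ≢ e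
    b≢e refl = cyclic⇒≢ (cyclic-rotate cyc) refl
    a≢e : a ≢ e
    a≢e refl = cyclic⇒≢ (cyclic-rotate (cyclic-rotate cyc)) refl
  ... | inj₁ abe = abe
  ... | inj₂ aeb = contradiction (shift-cyclic a<m e<m b<m aeb) (cyclic-asym cyc)

  shift-onArc : ∀ {a b x} → a < m → b < m → x < m → OnArc a b x ⇔ OnArc (shift a) (shift b) (shift x)
  shift-onArc {a} {b} {x} a<m b<m x<m =
    ⇔-sym (OnArc⇔ (shift a) (shift b) (shift x)) ⇔-∘ (mk⇔ to from ⇔-∘ OnArc⇔ a b x)
    where
    to : AtOrBetween a b x → AtOrBetween (shift a) (shift b) (shift x)
    to (inj₁ x≡a)         = inj₁ (cong shift x≡a)
    to (inj₂ (inj₁ x≡b))  = inj₂ (inj₁ (cong shift x≡b))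
    to (inj₂ (inj₂ axb))  = inj₂ (inj₂ (shift-cyclic a<m x<m b<m axb))
    from : AtOrBetween (shift a) (shift b) (shift x) → AtOrBetween a b x
    from (inj₁ eq)        = inj₁ (shift-injective x<m a<m eq)
    from (inj₂ (inj₁ eq)) = inj₂ (inj₁ (shift-injective x<m b<m eq))
    from (inj₂ (inj₂ axb)) = inj₂ (inj₂ (shift-cyclic⁻¹ a<m x<m b<m axb))

relabel : ∀ {n m} (f : ℕ → ℕ) → (∀ {x} → x < m → f x < m) →
          (∀ {x y} → x < m → y < m → f x ≡ f y → x ≡ y) →
          (∀ {k} → k < m → ∃ λ x → x < m × f x ≡ k) → Layout n m → Layout n m
relabel {n} {m} f f<m f-injective f-onto A = record
  { L           = f ∘ L A
  ; R           = f ∘ R A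
  ; L<m         = f<m ∘ L<m A
  ; R<m         = f<m ∘ R<m A
  ; L-injective = L-injective A ∘ f-injective (L<m A _) (L<m A _)
  ; R-injective = R-injective A ∘ f-injective (R<m A _) (R<m A _)
  ; L≢R         = λ u w → L≢R A u w ∘ f-injective (L<m A u) (R<m A w)
  ; occupied    = occupied′
  }
  where
  occupied′ : ∀ k → k < m → ∃ λ v → f (L A v) ≡ k ⊎ f (R A v) ≡ k
  occupied′ k k<m with f-onto k<m
  ... | x , x<m , fx≡k with occupied A x x<m
  ...   | v , inj₁ Lv≡x = v , inj₁ (trans (cong f Lv≡x) fx≡k)
  ...   | v , inj₂ Rv≡x = v , inj₂ (trans (cong f Rv≡x) fx≡k)

module ArcRep {n m} (G : Graph n) (α : Fin n → Seg m)
              (arc : IsProperArcRep G α) (sharp : IsSharp α) where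
  open IsProperRep arc

  A : Layout n m
  A = sharpLayout α sharp

  StartsIn : Fin n → Fin n → Set
  StartsIn u w = Cyclic (L A u) (L A w) (R A u)

  startsIn? : ∀ u w → Dec (StartsIn u w)
  startsIn? u w = cyclic? (L A u) (L A w) (R A u)

  startsIn⇒adjacent : ∀ {u w} → u ≢ w → StartsIn u w → Adj G u w
  startsIn⇒adjacent {u} {w} u≢w starts = Equivalence.from (adjacency u w u≢w)
    ( left (α w)
    , Equivalence.from (OnArc⇔ (L A u) (R A u) (L A w)) (inj₂ (inj₂ starts))
    , Equivalence.from (OnArc⇔ (L A w) (R A w) (L A w)) (inj₁ refl))

  -- Coordinates in which the left end of the base vertex b sits at 0.
  module Based (b : Fin n) where
    open Shift m (L A b) (L<m A b) public

    B : Layout n m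
    B = relabel shift shift<m shift-injective shift-onto A

    l r : Fin n → ℕ
    l = L B
    r = R B

    l-base : l b ≡ 0
    l-base = shift-c

    l-pos : ∀ {v} → v ≢ b → 0 < l v
    l-pos v≢b = shift-pos (L<m A _) (v≢b ∘ L-injective A)

    r-pos : ∀ v → 0 < r v
    r-pos v = shift-pos (R<m A v) (L≢R A b v ∘ ≡-sym)

    cyclic-from-base : ∀ {x y} → x < m → y < m → Cyclic (L A b) x y ⇔ (0 < shift x × shift x < shift y)
    cyclic-from-base {x} {y} x<m y<m = mk⇔
      (λ cyc → cyclic-from-0 (subst (λ t → Cyclic t (shift x) (shift y)) l-base
                                    (shift-cyclic (L<m A b) x<m y<m cyc)))
      (λ in-order → shift-cyclic⁻¹ (L<m A b) x<m y<m
                      (subst (λ t → Cyclic t (shift x) (shift y)) (≡-sym l-base) (inj₁ in-order)))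

    startsIn⇔ : ∀ {u w} → StartsIn u w ⇔ Cyclic (l u) (l w) (r u)
    startsIn⇔ {u} {w} = mk⇔ (shift-cyclic (L<m A u) (L<m A w) (R<m A u))
                            (shift-cyclic⁻¹ (L<m A u) (L<m A w) (R<m A u))

    onArc⇔ : ∀ v {x} → x < m → OnArc (L A v) (R A v) x ⇔ OnArc (l v) (r v) (shift x)
    onArc⇔ v x<m = shift-onArc (L<m A v) (R<m A v) x<m

    onBaseArc⇔ : ∀ {x} → x < m → OnArc (L A b) (R A b) x ⇔ shift x ≤ r b
    onBaseArc⇔ {x} x<m = mk⇔ to from
      where
      to : OnArc (L A b) (R A b) x → shift x ≤ r b
      to on with subst (λ t → OnArc t (r b) (shift x)) l-base (Equivalence.to (onArc⇔ b x<m) on)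
      ... | inj₁ (_ , _ , x≤r) = x≤r
      ... | inj₂ (() , _)
      from : shift x ≤ r b → OnArc (L A b) (R A b) x
      from x≤r = Equivalence.from (onArc⇔ b x<m)
                   (subst (λ t → OnArc t (r b) (shift x)) (≡-sym l-base) (inj₁ (z≤n , z≤n , x≤r)))

  -- If w starts inside u but z does not, then the left ends of u, w, z occur
  -- in this cyclic order (u ends between w and z).
  startsIn-order : ∀ {u w z} → u ≢ z → StartsIn u w → ¬ StartsIn u z →
                   Cyclic (L A u) (L A w) (L A z)
  startsIn-order {u} {w} {z} u≢z w-in-u ¬z-in-u =
    Equivalence.from (cyclic-from-base (L<m A w) (L<m A z)) (proj₁ 0<lw<ru , <-≤-trans (proj₂ 0<lw<ru) ru≤lz)
    where
    open Based u
    0<lw<ru : 0 < l w × l w < r u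
    0<lw<ru = Equivalence.to (cyclic-from-base (L<m A w) (R<m A u)) w-in-u
    ru≤lz : r u ≤ l z
    ru≤lz = ≮⇒≥ (λ lz<ru → ¬z-in-u (Equivalence.from (cyclic-from-base (L<m A z) (R<m A u))
                                      (l-pos (u≢z ∘ ≡-sym) , lz<ru)))

  -- If w starts inside u and z starts between u and w, then w starts inside
  -- z as well: otherwise the arc of z would lie inside the arc of u.
  startsIn-between : ∀ {u w z} → StartsIn u w → Cyclic (L A u) (L A z) (L A w) → StartsIn z w
  startsIn-between {u} {w} {z} w-in-u z-between with startsIn? z w
  ... | yes w-in-z  = w-in-z
  ... | no ¬w-in-z = contradiction z⊆u (proper z u z≢u)
    where
    open Based u
    z≢u : z ≢ u
    z≢u refl = cyclic⇒≢ z-between refl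
    lw<ru : l w < r u
    lw<ru = proj₂ (Equivalence.to (cyclic-from-base (L<m A w) (R<m A u)) w-in-u)
    lz<lw : l z < l w
    lz<lw = proj₂ (Equivalence.to (cyclic-from-base (L<m A z) (L<m A w)) z-between)
    ¬w-in-z′ : ¬ Cyclic (l z) (l w) (r z)
    ¬w-in-z′ = ¬w-in-z ∘ Equivalence.from startsIn⇔
    lz≤rz : l z ≤ r z
    lz≤rz = ≮⇒≥ (λ rz<lz → ¬w-in-z′ (inj₂ (inj₂ (rz<lz , lz<lw))))
    rz≤lw : r z ≤ l w
    rz≤lw = ≮⇒≥ (λ lw<rz → ¬w-in-z′ (inj₁ (lz<lw , lw<rz)))
    z⊆u : ∀ x → InArc (α z) x → InArc (α u) x
    z⊆u x on-z with Equivalence.to (onArc⇔ z (toℕ<n x)) on-z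
    ... | inj₁ (_ , _ , x≤rz) =
      Equivalence.from (onBaseArc⇔ (toℕ<n x)) (≤-trans x≤rz (≤-trans rz≤lw (<⇒≤ lw<ru)))
    ... | inj₂ (rz<lz , _) = contradiction lz≤rz (<⇒≱ rz<lz)

  adjacent⇒startsIn : ∀ {u w} → u ≢ w → Adj G u w → StartsIn u w ⊎ StartsIn w u
  adjacent⇒startsIn {u} {w} u≢w adj with Equivalence.to (adjacency u w u≢w) adj
  ... | x , on-u , on-w = by-cases (l w <? r u)
    where
    open Based u
    x≤ru : shift (toℕ x) ≤ r u
    x≤ru = Equivalence.to (onBaseArc⇔ (toℕ<n x)) on-u
    lw≢ru : l w ≢ r u
    lw≢ru eq = L≢R A w u (shift-injective (L<m A w) (R<m A u) eq)
    by-cases : Dec (l w < r u) → StartsIn u w ⊎ StartsIn w u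
    by-cases (yes lw<ru) =
      inj₁ (Equivalence.from (cyclic-from-base (L<m A w) (R<m A u)) (l-pos (u≢w ∘ ≡-sym) , lw<ru))
    by-cases (no lw≮ru) with Equivalence.to (onArc⇔ w (toℕ<n x)) on-w
    ... | inj₁ (_ , lw≤x , _) = contradiction (≤-antisym (≤-trans lw≤x x≤ru) (≮⇒≥ lw≮ru)) lw≢ru
    ... | inj₂ (_ , inj₁ lw≤x) = contradiction (≤-antisym (≤-trans lw≤x x≤ru) (≮⇒≥ lw≮ru)) lw≢ru
    ... | inj₂ (rw<lw , inj₂ _) = inj₂ (Equivalence.from startsIn⇔
            (subst (λ t → Cyclic (l w) t (r w)) (≡-sym l-base) (inj₂ (inj₁ (r-pos w , rw<lw)))))

  -- The comparisons of endpoints in the coordinates based at b, expressed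
  -- through the cyclic order of left ends and the relation StartsIn.
  module Comparisons (b : Fin n) where
    open Based b public

    -- The arc of u passes over the base point, i.e. wraps around 0.
    Wraps : Fin n → Set
    Wraps u = r u < l u

    wraps⇔ : ∀ u → Wraps u ⇔ StartsIn u b
    wraps⇔ u = mk⇔ to from
      where
      to : Wraps u → StartsIn u b
      to ru<lu = Equivalence.from startsIn⇔
        (subst (λ t → Cyclic (l u) t (r u)) (≡-sym l-base) (inj₂ (inj₁ (r-pos u , ru<lu))))
      from : StartsIn u b → Wraps u
      from b-in-u with subst (λ t → Cyclic (l u) t (r u)) l-base (Equivalence.to startsIn⇔ b-in-u)
      ... | inj₁ (() , _)
      ... | inj₂ (inj₁ (_ , ru<lu)) = ru<lu
      ... | inj₂ (inj₂ (ru<lu , _)) = ru<lu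

    l<l⇒≢ : ∀ {u w} → l u < l w → u ≢ w
    l<l⇒≢ lu<lw refl = <-irrefl refl lu<lw

    StartsBefore : Fin n → Fin n → Set
    StartsBefore u w = (u ≡ b × w ≢ b) ⊎ Cyclic (L A b) (L A u) (L A w)

    l<l⇔ : ∀ u w → l u < l w ⇔ StartsBefore u w
    l<l⇔ u w = mk⇔ to from
      where
      to : l u < l w → StartsBefore u w
      to lu<lw with u ≟ᶠ b
      ... | yes refl = inj₁ (refl , l<l⇒≢ lu<lw ∘ ≡-sym)
      ... | no u≢b   = inj₂ (Equivalence.from (cyclic-from-base (L<m A u) (L<m A w)) (l-pos u≢b , lu<lw))
      from : StartsBefore u w → l u < l w
      from (inj₁ (refl , w≢b)) = subst (_< l w) (≡-sym l-base) (l-pos w≢b)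
      from (inj₂ cyc)          = proj₂ (Equivalence.to (cyclic-from-base (L<m A u) (L<m A w)) cyc)

    StartsBeforeEnd : Fin n → Fin n → Set
    StartsBeforeEnd u w = (¬ Wraps u × (l w < l u ⊎ u ≡ w ⊎ StartsIn u w))
                        ⊎ (Wraps u × l w < l u × StartsIn u w)

    l<r⇔ : ∀ u w → l w < r u ⇔ StartsBeforeEnd u w
    l<r⇔ u w = mk⇔ to from
      where
      to : l w < r u → StartsBeforeEnd u w
      to lw<ru with r u <? l u
      ... | yes wraps = inj₂ (wraps , <-trans lw<ru wraps ,
                              Equivalence.from startsIn⇔ (inj₂ (inj₁ (lw<ru , wraps))))
      ... | no ¬wraps with <-cmp (l w) (l u)
      ...   | tri< lw<lu _ _ = inj₁ (¬wraps , inj₁ lw<lu)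
      ...   | tri≈ _ lw≡lu _ = inj₁ (¬wraps , inj₂ (inj₁ (L-injective B (≡-sym lw≡lu))))
      ...   | tri> _ _ lu<lw = inj₁ (¬wraps , inj₂ (inj₂ (Equivalence.from startsIn⇔ (inj₁ (lu<lw , lw<ru)))))
      from : StartsBeforeEnd u w → l w < r u
      from (inj₁ (¬wraps , inj₁ lw<lu))        = <-≤-trans lw<lu (≮⇒≥ ¬wraps)
      from (inj₁ (¬wraps , inj₂ (inj₁ refl)))  = ≤∧≢⇒< (≮⇒≥ ¬wraps) (L≢R B u u)
      from (inj₁ (¬wraps , inj₂ (inj₂ w-in-u))) with Equivalence.to startsIn⇔ w-in-u
      ... | inj₁ (_ , lw<ru)        = lw<ru
      ... | inj₂ (inj₁ (_ , ru<lu)) = contradiction ru<lu ¬wraps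
      ... | inj₂ (inj₂ (ru<lu , _)) = contradiction ru<lu ¬wraps
      from (inj₂ (_ , lw<lu , w-in-u)) with Equivalence.to startsIn⇔ w-in-u
      ... | inj₁ (lu<lw , _)        = contradiction lu<lw (<-asym lw<lu)
      ... | inj₂ (inj₁ (lw<ru , _)) = lw<ru
      ... | inj₂ (inj₂ (_ , lu<lw)) = contradiction lu<lw (<-asym lw<lu)

    not-nested : ∀ {w u} → w ≢ u → ¬ (∀ y → OnArc (l w) (r w) y → OnArc (l u) (r u) y)
    not-nested {w} {u} w≢u w⊆u = proper w u w≢u (λ x on-w →
      Equivalence.from (onArc⇔ u (toℕ<n x)) (w⊆u _ (Equivalence.to (onArc⇔ w (toℕ<n x)) on-w)))

    ends-in-order : ∀ {u w} → ¬ Wraps u → ¬ Wraps w → l u < l w → r u < r w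
    ends-in-order {u} {w} ¬wraps-u ¬wraps-w lu<lw with r u <? r w
    ... | yes ru<rw = ru<rw
    ... | no ru≮rw  = contradiction w⊆u (not-nested (l<l⇒≢ lu<lw ∘ ≡-sym))
      where
      w⊆u : ∀ y → OnArc (l w) (r w) y → OnArc (l u) (r u) y
      w⊆u y (inj₁ (_ , lw≤y , y≤rw)) =
        inj₁ (≮⇒≥ ¬wraps-u , ≤-trans (<⇒≤ lu<lw) lw≤y , ≤-trans y≤rw (≮⇒≥ ru≮rw))
      w⊆u y (inj₂ (rw<lw , _))       = contradiction rw<lw ¬wraps-w

    wrapped-ends-in-order : ∀ {u w} → Wraps u → Wraps w → l u < l w → r u < r w
    wrapped-ends-in-order {u} {w} wraps-u wraps-w lu<lw with r u <? r w
    ... | yes ru<rw = ru<rw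
    ... | no ru≮rw  = contradiction w⊆u (not-nested (l<l⇒≢ lu<lw ∘ ≡-sym))
      where
      w⊆u : ∀ y → OnArc (l w) (r w) y → OnArc (l u) (r u) y
      w⊆u y (inj₁ (lw≤rw , _))         = contradiction lw≤rw (<⇒≱ wraps-w)
      w⊆u y (inj₂ (_ , inj₁ lw≤y))     = inj₂ (wraps-u , inj₁ (≤-trans (<⇒≤ lu<lw) lw≤y))
      w⊆u y (inj₂ (_ , inj₂ y≤rw))     = inj₂ (wraps-u , inj₂ (≤-trans y≤rw (≮⇒≥ ru≮rw)))

    wrapped-ends-first : ∀ {u w} → Wraps u → ¬ Wraps w → r u < r w
    wrapped-ends-first {u} {w} wraps-u ¬wraps-w with r u <? r w
    ... | yes ru<rw = ru<rw
    ... | no ru≮rw  = contradiction w⊆u (not-nested w≢u)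
      where
      w≢u : w ≢ u
      w≢u refl = ¬wraps-w wraps-u
      w⊆u : ∀ y → OnArc (l w) (r w) y → OnArc (l u) (r u) y
      w⊆u y (inj₁ (_ , _ , y≤rw)) = inj₂ (wraps-u , inj₂ (≤-trans y≤rw (≮⇒≥ ru≮rw)))
      w⊆u y (inj₂ (rw<lw , _))    = contradiction rw<lw ¬wraps-w

    EndsBefore : Fin n → Fin n → Set
    EndsBefore u w = (Wraps u × ¬ Wraps w)
                   ⊎ (Wraps u × Wraps w × l u < l w)
                   ⊎ (¬ Wraps u × ¬ Wraps w × l u < l w)

    r<r⇔ : ∀ u w → r u < r w ⇔ EndsBefore u w
    r<r⇔ u w = mk⇔ to from
      where
      from : EndsBefore u w → r u < r w
      from (inj₁ (wraps-u , ¬wraps-w))                 = wrapped-ends-first wraps-u ¬wraps-w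
      from (inj₂ (inj₁ (wraps-u , wraps-w , lu<lw)))   = wrapped-ends-in-order wraps-u wraps-w lu<lw
      from (inj₂ (inj₂ (¬wraps-u , ¬wraps-w , lu<lw))) = ends-in-order ¬wraps-u ¬wraps-w lu<lw
      same-start : l u ≡ l w → ¬ (r u < r w)
      same-start lu≡lw = <-irrefl (cong r (L-injective B lu≡lw))
      to : r u < r w → EndsBefore u w
      to ru<rw with r u <? l u | r w <? l w
      ... | yes wraps-u | no ¬wraps-w  = inj₁ (wraps-u , ¬wraps-w)
      ... | no ¬wraps-u | yes wraps-w  = contradiction (wrapped-ends-first wraps-w ¬wraps-u) (<-asym ru<rw)
      ... | yes wraps-u | yes wraps-w with <-cmp (l u) (l w)
      ...   | tri< lu<lw _ _ = inj₂ (inj₁ (wraps-u , wraps-w , lu<lw))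
      ...   | tri≈ _ lu≡lw _ = contradiction ru<rw (same-start lu≡lw)
      ...   | tri> _ _ lw<lu = contradiction (wrapped-ends-in-order wraps-w wraps-u lw<lu) (<-asym ru<rw)
      to ru<rw | no ¬wraps-u | no ¬wraps-w with <-cmp (l u) (l w)
      ...   | tri< lu<lw _ _ = inj₂ (inj₂ (¬wraps-u , ¬wraps-w , lu<lw))
      ...   | tri≈ _ lu≡lw _ = contradiction ru<rw (same-start lu≡lw)
      ...   | tri> _ _ lw<lu = contradiction (ends-in-order ¬wraps-w ¬wraps-u lw<lu) (<-asym ru<rw)

same-circular-order⁻¹ : ∀ {n m} {α α' : Fin n → Seg m} → SameCircularOrder α α' → SameCircularOrder α' α
same-circular-order⁻¹ same u v w = ⇔-sym (same u v w)

module _ {n m} (G : Graph n) (α α' : Fin n → Seg m)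
         (arc : IsProperArcRep G α) (sharp : IsSharp α)
         (arc' : IsProperArcRep G α') (sharp' : IsSharp α') where
  private
    module X  = ArcRep G α arc sharp
    module X' = ArcRep G α' arc' sharp'

  -- If w starts inside u in α but u starts inside w in α' (and α, α' have
  -- the same circular order), then u is universal: every z not starting
  -- inside u in α starts between w and u, hence u starts inside z in α'.
  flip⇒universal : SameCircularOrder α α' → ∀ {u w} →
                   X.StartsIn u w → X'.StartsIn w u → Universal G u
  flip⇒universal same {u} {w} w-in-u u-in-w z z≢u with X.startsIn? u z
  ... | yes z-in-u = X.startsIn⇒adjacent (z≢u ∘ ≡-sym) z-in-u
  ... | no ¬z-in-u = Graph.sym G (X'.startsIn⇒adjacent z≢u (X'.startsIn-between u-in-w
                       (cyclic-rotate (Equivalence.to (same u w z)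
                          (X.startsIn-order (z≢u ∘ ≡-sym) w-in-u ¬z-in-u)))))

-- With at most one universal vertex, "w starts inside u" is determined by G
-- and the circular order: otherwise u and w would both be universal.
startsIn-preserved :
  ∀ {n m} (G : Graph n) → AtMostOneUniversal G → (α α' : Fin n → Seg m)
  (arc : IsProperArcRep G α) (sharp : IsSharp α) (arc' : IsProperArcRep G α') (sharp' : IsSharp α') →
  SameCircularOrder α α' → ∀ {u w} →
  ArcRep.StartsIn G α arc sharp u w → ArcRep.StartsIn G α' arc' sharp' u w
startsIn-preserved G unique α α' arc sharp arc' sharp' same {u} {w} w-in-u with u ≟ᶠ w
... | yes refl = contradiction refl (cyclic⇒≢ w-in-u)
... | no u≢w with ArcRep.adjacent⇒startsIn G α' arc' sharp' u≢w
                   (ArcRep.startsIn⇒adjacent G α arc sharp u≢w w-in-u)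
...   | inj₁ w-in-u′ = w-in-u′
...   | inj₂ u-in-w′ = contradiction
  (unique u w (flip⇒universal G α α' arc sharp arc' sharp' same w-in-u u-in-w′)
              (flip⇒universal G α' α arc' sharp' arc sharp
                  (same-circular-order⁻¹ {α = α} {α' = α'} same) u-in-w′ w-in-u))
  u≢w

module BasedTransfer {n m} (G : Graph n) (unique : AtMostOneUniversal G) (α α' : Fin n → Seg m)
  (arc : IsProperArcRep G α) (sharp : IsSharp α) (arc' : IsProperArcRep G α') (sharp' : IsSharp α')
  (same : SameCircularOrder α α') (b : Fin n) where
  module X  = ArcRep G α arc sharp
  module X' = ArcRep G α' arc' sharp'
  module C  = X.Comparisons b
  module C' = X'.Comparisons b

  startsIn : ∀ {u w} → X.StartsIn u w ⇔ X'.StartsIn u w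
  startsIn = mk⇔ (startsIn-preserved G unique α α' arc sharp arc' sharp' same)
                 (startsIn-preserved G unique α' α arc' sharp' arc sharp
                    (same-circular-order⁻¹ {α = α} {α' = α'} same))

  wraps : ∀ {u} → C.Wraps u ⇔ C'.Wraps u
  wraps {u} = ⇔-sym (C'.wraps⇔ u) ⇔-∘ (startsIn ⇔-∘ C.wraps⇔ u)

  startsBefore : ∀ {u w} → C.StartsBefore u w → C'.StartsBefore u w
  startsBefore         (inj₁ u≡b×w≢b) = inj₁ u≡b×w≢b
  startsBefore {u} {w} (inj₂ cyc)     = inj₂ (Equivalence.to (same b u w) cyc)

  l<l : ∀ {u w} → C.l u < C.l w → C'.l u < C'.l w
  l<l {u} {w} = Equivalence.from (C'.l<l⇔ u w) ∘ startsBefore ∘ Equivalence.to (C.l<l⇔ u w)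

  ¬wraps : ∀ {u} → ¬ C.Wraps u → ¬ C'.Wraps u
  ¬wraps ¬w = ¬w ∘ Equivalence.from wraps

  startsBeforeEnd : ∀ {u w} → C.StartsBeforeEnd u w → C'.StartsBeforeEnd u w
  startsBeforeEnd (inj₁ (¬w , inj₁ lw<lu))        = inj₁ (¬wraps ¬w , inj₁ (l<l lw<lu))
  startsBeforeEnd (inj₁ (¬w , inj₂ (inj₁ u≡w)))   = inj₁ (¬wraps ¬w , inj₂ (inj₁ u≡w))
  startsBeforeEnd (inj₁ (¬w , inj₂ (inj₂ w-in-u))) =
    inj₁ (¬wraps ¬w , inj₂ (inj₂ (Equivalence.to startsIn w-in-u)))
  startsBeforeEnd (inj₂ (w , lw<lu , w-in-u))     =
    inj₂ (Equivalence.to wraps w , l<l lw<lu , Equivalence.to startsIn w-in-u)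

  endsBefore : ∀ {u w} → C.EndsBefore u w → C'.EndsBefore u w
  endsBefore (inj₁ (wu , ¬ww))                = inj₁ (Equivalence.to wraps wu , ¬wraps ¬ww)
  endsBefore (inj₂ (inj₁ (wu , ww , lu<lw)))   =
    inj₂ (inj₁ (Equivalence.to wraps wu , Equivalence.to wraps ww , l<l lu<lw))
  endsBefore (inj₂ (inj₂ (¬wu , ¬ww , lu<lw))) = inj₂ (inj₂ (¬wraps ¬wu , ¬wraps ¬ww , l<l lu<lw))

based-same-endpoint-order :
  ∀ {n m} (G : Graph n) → AtMostOneUniversal G → (α α' : Fin n → Seg m)
  (arc : IsProperArcRep G α) (sharp : IsSharp α) (arc' : IsProperArcRep G α') (sharp' : IsSharp α') →
  SameCircularOrder α α' → (b : Fin n) →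
  SameEndpointOrder (ArcRep.Based.B G α arc sharp b) (ArcRep.Based.B G α' arc' sharp' b)
based-same-endpoint-order G unique α α' arc sharp arc' sharp' same b = record
  { left-left   = λ u w → ⇔-sym (C'.l<l⇔ u w) ⇔-∘ (mk⇔ T.startsBefore T'.startsBefore ⇔-∘ C.l<l⇔ u w)
  ; left-right  = λ u w → ⇔-sym (C'.l<r⇔ u w) ⇔-∘ (mk⇔ T.startsBeforeEnd T'.startsBeforeEnd ⇔-∘ C.l<r⇔ u w)
  ; right-right = λ u w → ⇔-sym (C'.r<r⇔ u w) ⇔-∘ (mk⇔ T.endsBefore T'.endsBefore ⇔-∘ C.r<r⇔ u w)
  }
  where
  module T  = BasedTransfer G unique α α' arc sharp arc' sharp' same b
  module T' = BasedTransfer G unique α' α arc' sharp' arc sharp (same-circular-order⁻¹ {α = α} {α' = α'} same) b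
  module C  = T.C
  module C' = T.C'

[m%d+n]%d≡[m+n]%d : ∀ a b d .{{_ : NonZero d}} → (a % d + b) % d ≡ (a + b) % d
[m%d+n]%d≡[m+n]%d a b d = begin
  (a % d + b) % d           ≡⟨ %-distribˡ-+ (a % d) b d ⟩
  (a % d % d + b % d) % d   ≡⟨ cong (λ t → (t + b % d) % d) (m%n%n≡m%n a d) ⟩
  (a % d + b % d) % d       ≡⟨ %-distribˡ-+ a b d ⟨
  (a + b) % d               ∎
  where open ≡-Reasoning

shift≡mod : ∀ k c (c<M : c < suc k) {x} → x < suc k →
            Shift.shift (suc k) c c<M x ≡ (x + (suc k ∸ c)) % suc k
shift≡mod k c c<M {x} x<M with c ≤? x
... | yes c≤x = begin
  x ∸ c                        ≡⟨ m<n⇒m%n≡m (≤-<-trans (m∸n≤m x c) x<M) ⟨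
  (x ∸ c) % M                  ≡⟨ [m+n]%n≡m%n (x ∸ c) M ⟨
  (x ∸ c + M) % M              ≡⟨ cong (λ t → (x ∸ c + t) % M) (m+[n∸m]≡n (<⇒≤ c<M)) ⟨
  (x ∸ c + (c + (M ∸ c))) % M  ≡⟨ cong (_% M) (+-assoc (x ∸ c) c (M ∸ c)) ⟨
  (x ∸ c + c + (M ∸ c)) % M    ≡⟨ cong (λ t → (t + (M ∸ c)) % M) (m∸n+n≡m c≤x) ⟩
  (x + (M ∸ c)) % M            ∎
  where
  open ≡-Reasoning
  M : ℕ
  M = suc k
... | no c≰x = ≡-sym (m<n⇒m%n≡m (subst (x + (suc k ∸ c) <_) (m+[n∸m]≡n (<⇒≤ c<M))
                                       (+-monoˡ-< (suc k ∸ c) (≰⇒> c≰x))))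

-- If x lies as far after c as y lies after c', then the rotation taking c to
-- c' takes x to y.
shift-equal⇒rotate : ∀ {k} (c c' x y : Fin (suc k)) →
  Shift.shift (suc k) (toℕ c) (toℕ<n c) (toℕ x) ≡ Shift.shift (suc k) (toℕ c') (toℕ<n c') (toℕ y) →
  rotate (k + toℕ c' + (suc k ∸ toℕ c)) x ≡ y
shift-equal⇒rotate {k} c c' x y same-distance = toℕ-injective (begin
  toℕ (rotate (k + C' + Δ) x)          ≡⟨ toℕ-fromℕ< _ ⟩
  (suc X + (k + C' + Δ)) % M           ≡⟨ cong (_% M) (regroup X k C' Δ) ⟩
  ((X + Δ) + (C' + M)) % M             ≡⟨ [m%d+n]%d≡[m+n]%d (X + Δ) (C' + M) M ⟨
  ((X + Δ) % M + (C' + M)) % M         ≡⟨ cong (λ t → (t + (C' + M)) % M) (shift≡mod k C (toℕ<n c) (toℕ<n x)) ⟨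
  (after-c X + (C' + M)) % M           ≡⟨ cong (λ t → (t + (C' + M)) % M) same-distance ⟩
  (after-c' Y + (C' + M)) % M          ≡⟨ cong (λ t → (t + (C' + M)) % M) (shift≡mod k C' (toℕ<n c') (toℕ<n y)) ⟩
  ((Y + Δ') % M + (C' + M)) % M        ≡⟨ [m%d+n]%d≡[m+n]%d (Y + Δ') (C' + M) M ⟩
  ((Y + Δ') + (C' + M)) % M            ≡⟨ cong (_% M) (regroup′ Y Δ' C' M) ⟩
  (Y + (Δ' + C') + M) % M              ≡⟨ cong (λ t → (Y + t + M) % M) (m∸n+n≡m (<⇒≤ (toℕ<n c'))) ⟩
  (Y + M + M) % M                      ≡⟨ [m+n]%n≡m%n (Y + M) M ⟩
  (Y + M) % M                          ≡⟨ [m+n]%n≡m%n Y M ⟩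
  Y % M                                ≡⟨ m<n⇒m%n≡m (toℕ<n y) ⟩
  Y                                    ∎)
  where
  open ≡-Reasoning
  M X Y C C' Δ Δ' : ℕ
  M  = suc k
  X  = toℕ x
  Y  = toℕ y
  C  = toℕ c
  C' = toℕ c'
  Δ  = M ∸ C
  Δ' = M ∸ C'
  after-c after-c' : ℕ → ℕ
  after-c  = Shift.shift M C (toℕ<n c)
  after-c' = Shift.shift M C' (toℕ<n c')
  regroup : ∀ X k C' Δ → suc X + (k + C' + Δ) ≡ (X + Δ) + (C' + suc k)
  regroup = solve-∀
  regroup′ : ∀ Y Δ' C' M → (Y + Δ') + (C' + M) ≡ Y + (Δ' + C') + M
  regroup′ = solve-∀

-- Part (2) of the lemma: based at the left end of a fixed vertex, the two
-- shifted layouts coincide, so α' is α followed by a rotation.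
arc-rep-unique-up-to-rotation :
  ∀ {n m} (G : Graph n) → AtMostOneUniversal G → (α α' : Fin n → Seg m) →
  IsProperArcRep G α → IsSharp α → IsProperArcRep G α' → IsSharp α' →
  SameCircularOrder α α' → ∃ λ s → ∀ v → α' v ≡ rotateSeg s (α v)
arc-rep-unique-up-to-rotation {zero} G unique α α' arc sharp arc' sharp' same = 0 , λ ()
arc-rep-unique-up-to-rotation {suc n} {zero} G unique α α' arc sharp arc' sharp' same
  with IsSharp.size sharp
... | ()
arc-rep-unique-up-to-rotation {suc n} {suc k} G unique α α' arc sharp arc' sharp' same =
  k + toℕ c' + (suc k ∸ toℕ c) , λ v →
    ×-≡,≡→≡ ( ≡-sym (shift-equal⇒rotate c c' _ _ (proj₁ (shifted-agree v)))
            , ≡-sym (shift-equal⇒rotate c c' _ _ (proj₂ (shifted-agree v))))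
  where
  c c' : Fin (suc k)
  c  = left (α fzero)
  c' = left (α' fzero)
  B B' : Layout (suc n) (suc k)
  B  = ArcRep.Based.B G α arc sharp fzero
  B' = ArcRep.Based.B G α' arc' sharp' fzero
  shifted-agree : ∀ v → L B v ≡ L B' v × R B v ≡ R B' v
  shifted-agree = layout-unique B B' (based-same-endpoint-order G unique α α' arc sharp arc' sharp' same fzero)

lemma5p3 : (∀ {n m} (G : Graph n) (α α' : Fin n → Seg m) →
    IsProperIntervalRep G α → IsSharp α →
    IsProperIntervalRep G α' → IsSharp α' →
    SameLinearOrder α α' →
    ∀ v → α v ≡ α' v)
    ×
    (∀ {n m} (G : Graph n) → AtMostOneUniversal G → (α α' : Fin n → Seg m) →
    IsProperArcRep G α → IsSharp α →
    IsProperArcRep G α' → IsSharp α' →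
    SameCircularOrder α α' →
    ∃ λ s → ∀ v → α' v ≡ rotateSeg s (α v))
lemma5p3 = interval-rep-unique , arc-rep-unique-up-to-rotation
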